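{- Let $D=(d_1,\ldots,d_k)$ be a domino shave position and $D'=(d'_1,\ldots,d'_k)$ its normalized position, with stage index sets $E_1,E_2,\ldots,E_f$ produced by the normalization algorithm. Then: (1) the index set $\{1,\ldots,k\}$ is partitioned into $E_1,E_2,\ldots,E_f$; (2) if $i\in E_a$, $j\in E_b$ and $a<b$, then the left and right spots of $d'_i$ are smaller than the left and right spots of $d'_j$; (3) let $i<j$, $i\in E_a$, $j\in E_b$: if $a<b$ then $d'_j$ does not prevent $d'_i$ from being played; if $a>b$ then $d'_j$ does prevent $d'_i$ from being played.
   Context: A domino is an ordered pair $(l,r)$ of non-negative integers (left spot $l$, right spot $r$); it is blue if $l<r$, red if $l>r$, green if $l=r$. A domino shave position is a finite sequence $d_1,\ldots,d_k$ of dominoes $d_i=(l_i,r_i)$. Left may remove a blue or green $d_i$ together with all $d_j$, $j>i$ (leaving $d_1,\ldots,d_{i-1}$), provided $l_i\le l_j$ and $l_i\le r_j$ for all $j\ge i$; Right may do the same with a red or green $d_i$ provided $r_i\le l_j$ and $r_i\le r_j$ for all $j\ge i$. Normal play. A domino is playable if some player is allowed to remove it. For $j>i$, $d_j$ prevents $d_i$ from being played if for each player allowed by colour to remove $d_i$ the required inequalities fail for the index $j$. Normalization algorithm: let $U=\{1,\ldots,k\}$, $s=1$, $p=1$. While $U\neq\emptyset$: let $B$ be the maximal set of consecutive integers contained in $U$ that contains $\max U$; let $E_s$ be the set of $i\in B$ such that $d_i$ is playable in the domino shave position consisting of the dominoes $d_i$, $i\in B$, in order; for each $i\in E_s$ set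 $d'_i=(p,p+1)$ if $d_i$ is blue, $d'_i=(p+1,p)$ if red, $d'_i=(p,p)$ if green; then remove $E_s$ from $U$ and set $s:=s+1$, $p:=p+2$. The normalized position is $D'=(d'_1,\ldots,d'_k)$. -}

module Defs where

open import Data.Bool using (Bool; true; false; if_then_else_; T)
open import Data.Bool.Properties using (T?)
open import Data.Nat using (ℕ; zero; suc; _+_; _*_; _≤_; _≤?_; _<ᵇ_; _≡ᵇ_)
open import Data.Product using (_×_; _,_; proj₁; proj₂)
open import Data.Sum using (_⊎_)
open import Data.Empty using (⊥)
open import Data.Fin using (Fin; toℕ)
open import Data.Fin.Properties using () renaming (_≟_ to _≟ᶠ_)
open import Data.List using (List; []; _∷_; map; reverse; filter; drop; allFin; length)
open import Data.List.Relation.Unary.All using (All; all?)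
open import Data.Vec using (Vec; lookup; tabulate)
open import Relation.Nullary using (¬_; Dec; yes; no; does; ¬?)
open import Relation.Nullary.Decidable using (_×-dec_; _⊎-dec_)

Domino : Set
Domino = ℕ × ℕ

left right : Domino → ℕ
left  = proj₁
right = proj₂

data Colour : Set where
  blue red green : Colour

colour : Domino → Colour
colour (l , r) = if l <ᵇ r then blue else (if r <ᵇ l then red else green)

leftColour : Colour → Bool
leftColour blue  = true
leftColour red   = false
leftColour green = true

rightColour : Colour → Bool
rightColour blue  = false
rightColour red   = true
rightColour green = true

LeftAllowed RightAllowed : Domino → Set
LeftAllowed  d = T (leftColour  (colour d))
RightAllowed d = T (rightColour (colour d))

-- The inequalities required of a later (or the same) domino e when
-- Left (resp. Right) removes d:  l_d ≤ l_e and l_d ≤ r_e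
-- (resp. r_d ≤ l_e and r_d ≤ r_e).
LeftReq RightReq : Domino → Domino → Set
LeftReq  d e = left d  ≤ left e × left d  ≤ right e
RightReq d e = right d ≤ left e × right d ≤ right e

Position : Set
Position = List Domino

-- For a position written as d ∷ rest (the dominoes d_i, d_j with j > i),
-- can Left / Right remove d (the conditions range over all j ≥ i)?
LeftCanHead RightCanHead PlayableHead : Position → Set
LeftCanHead []         = ⊥
LeftCanHead (d ∷ rest) = LeftAllowed d × All (LeftReq d) (d ∷ rest)
RightCanHead []         = ⊥
RightCanHead (d ∷ rest) = RightAllowed d × All (RightReq d) (d ∷ rest)
PlayableHead P = LeftCanHead P ⊎ RightCanHead P

-- d_i is playable in P (0-based index i): some player may remove it.
-- The dominoes d_j with j ≥ i are exactly the suffix  drop i P.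
Playable : Position → ℕ → Set
Playable P i = PlayableHead (drop i P)

playableHead? : (P : Position) → Dec (PlayableHead P)
playableHead? [] = no λ { (Data.Sum.inj₁ ()) ; (Data.Sum.inj₂ ()) }
playableHead? (d ∷ rest) =
  (T? _ ×-dec all? (λ e → (left d ≤? left e) ×-dec (left d ≤? right e)) (d ∷ rest))
  ⊎-dec
  (T? _ ×-dec all? (λ e → (right d ≤? left e) ×-dec (right d ≤? right e)) (d ∷ rest))

-- "e (= d_j, j > i) prevents d (= d_i) from being played": for each player
-- allowed by colour to remove d, the required inequalities fail for e.
Prevents : (e d : Domino) → Set
Prevents e d = (LeftAllowed d → ¬ LeftReq d e) × (RightAllowed d → ¬ RightReq d e)

-- Normalization algorithm, for a position D = (d_0,…,d_{k-1}) given as a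
-- vector; indices are Fin k.  U is kept as a list in DECREASING order.

module Normalization {k : ℕ} (D : Vec Domino k) where

  open import Data.List.Membership.DecPropositional (_≟ᶠ_ {k}) using (_∈?_)

  run : Fin k → List (Fin k) → List (Fin k)
  run x []       = []
  run x (y ∷ ys) = if suc (toℕ y) ≡ᵇ toℕ x then y ∷ run y ys else []

  -- B: maximal set of consecutive integers in U containing max U
  -- (in decreasing order)
  block : List (Fin k) → List (Fin k)
  block []       = []
  block (x ∷ xs) = x ∷ run x xs

  -- Given the indices of a block in INCREASING order, the sub-position is
  -- map (lookup D) of it; the element b at the front of a suffix (b ∷ bs)
  -- is playable in that sub-position iff PlayableHead (map (lookup D) (b ∷ bs)).
  playableIdxs : List (Fin k) → List (Fin k)
  playableIdxs []       = []
  playableIdxs (b ∷ bs) =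
    if does (playableHead? (map (lookup D) (b ∷ bs)))
    then b ∷ playableIdxs bs
    else playableIdxs bs

  stageSet : List (Fin k) → List (Fin k)
  stageSet U = playableIdxs (reverse (block U))

  removeAll : List (Fin k) → List (Fin k) → List (Fin k)
  removeAll E U = filter (λ u → ¬? (u ∈? E)) U

  -- the while loop; fuel k suffices since each stage removes max U
  -- (the last domino of a block is always playable in it)
  loop : ℕ → List (Fin k) → List (List (Fin k))
  loop zero    U        = []
  loop (suc n) []       = []
  loop (suc n) (u ∷ us) = stageSet (u ∷ us) ∷ loop n (removeAll (stageSet (u ∷ us)) (u ∷ us))

  -- E_1, …, E_f  (as a list; stage s+1 of the paper is element s here)
  stages : List (List (Fin k))
  stages = loop k (reverse (allFin k))

  -- 0-based index of the first stage containing i (length stages if none)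
  stageIndexIn : List (List (Fin k)) → Fin k → ℕ
  stageIndexIn []       i = 0
  stageIndexIn (E ∷ Es) i = if does (i ∈? E) then 0 else suc (stageIndexIn Es i)

  recolour : Colour → ℕ → Domino
  recolour blue  p = p , suc p
  recolour red   p = suc p , p
  recolour green p = p , p

  normalized : Vec Domino k
  normalized = tabulate λ i →
    recolour (colour (lookup D i)) (2 * stageIndexIn stages i + 1)

{-# OPTIONS --safe #-}
module Submission where

-- The largest remaining index is the last domino of its block, which is always
-- playable there; so every stage is non-empty, the loop exhausts all k indices
-- within its k rounds, and the stages partition them.  Stage s is recoloured
-- with spots in {2s+1, 2s+2}, so every spot of an earlier stage lies strictly
-- below every spot of a later one: a later-stage domino never prevents an
-- earlier-stage one (whoever may move it needs spots at least its own), while an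
-- earlier-stage domino prevents every later-stage one.

open import Defs
open import Data.Nat using (ℕ)
open import Data.Fin using (Fin; toℕ; _<_)
open import Data.Product using (_×_; ∃-syntax)
open import Data.List using (List; []; lookup; length)
open import Data.List.Membership.Propositional using (_∈_)
open import Data.Vec using (Vec) renaming (lookup to vlookup)
open import Relation.Binary.PropositionalEquality using (_≡_; _≢_)
open import Relation.Nullary using (¬_)

open import Data.Nat as ℕ using (zero; suc; _+_; _*_; _≤_; _<ᵇ_)
open import Data.Nat.Properties
  using (≤-refl; ≤-trans; <-≤-trans; <⇒≤; <⇒≱; ≮⇒≥; <ᵇ⇒<; <⇒<ᵇ; n≤1+n; ≤-pred; +-suc; +-monoˡ-≤; *-monoʳ-≤)
open import Data.Fin using (zero; suc)
open import Data.Fin.Properties using (_≟_)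
open import Data.Product using (_,_; proj₁; proj₂)
open import Data.Sum using (_⊎_; inj₁; inj₂)
open import Data.Empty using (⊥-elim)
open import Data.Unit using (tt)
open import Data.Bool using (true; false; T)
open import Data.List using (_∷_; _++_; [_]; reverse; map; allFin)
open import Data.List.Relation.Unary.All using (_∷_; [])
open import Data.List.Relation.Unary.Any using (here; there)
open import Data.List.Relation.Unary.Any.Properties using (reverse⁺; reverse⁻)
open import Data.List.Properties using (unfold-reverse; filter-notAll; length-reverse; length-tabulate)
open import Data.List.Membership.Propositional.Properties using (∈-filter⁺; ∈-filter⁻; ∈-allFin)
open import Data.Vec.Properties using (lookup∘tabulate)
open import Relation.Binary.PropositionalEquality using (refl; sym; subst; cong; trans)
open import Relation.Nullary using (does; yes; no; ¬?)
open import Relation.Nullary.Decidable using (dec-true; dec-false)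

allowed : ∀ d → LeftAllowed d ⊎ RightAllowed d
allowed d with colour d
... | blue  = inj₁ tt
... | red   = inj₂ tt
... | green = inj₁ tt

singleton-playable : ∀ d → PlayableHead (d ∷ [])
singleton-playable (l , r) with l <ᵇ r in l<ᵇr
... | true = inj₁ (tt , (≤-refl , <⇒≤ (<ᵇ⇒< l r (subst T (sym l<ᵇr) tt))) ∷ [])
... | false with r <ᵇ l in r<ᵇl
...   | true  = inj₂ (tt , (<⇒≤ (<ᵇ⇒< r l (subst T (sym r<ᵇl) tt)) , ≤-refl) ∷ [])
...   | false = inj₁ (tt , (≤-refl , ≮⇒≥ (λ r<l → subst T r<ᵇl (<⇒<ᵇ r<l))) ∷ [])

_≺_ : Domino → Domino → Set
d ≺ e = (left d ℕ.< left e) × (left d ℕ.< right e) × (right d ℕ.< left e) × (right d ℕ.< right e)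

≺⇒¬Prevents : ∀ {d e} → d ≺ e → ¬ Prevents e d
≺⇒¬Prevents {d} (ll , lr , rl , rr) (¬left , ¬right) with allowed d
... | inj₁ leftAllowed  = ¬left  leftAllowed  (<⇒≤ ll , <⇒≤ lr)
... | inj₂ rightAllowed = ¬right rightAllowed (<⇒≤ rl , <⇒≤ rr)

≻⇒Prevents : ∀ {d e} → e ≺ d → Prevents e d
≻⇒Prevents (ll , lr , _ , _) = (λ _ req → <⇒≱ ll (proj₁ req)) , (λ _ req → <⇒≱ lr (proj₁ req))

module NormalizationProperties {k : ℕ} (D : Vec Domino k) where
  open Normalization D
  open import Data.List.Membership.DecPropositional (_≟_ {k}) using (_∈?_)

  run-⊆ : ∀ {i} x xs → i ∈ run x xs → i ∈ xs
  run-⊆ x (y ∷ ys) i∈run with suc (toℕ y) ℕ.≡ᵇ toℕ x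
  run-⊆ x (y ∷ ys) (here i≡y)   | true = here i≡y
  run-⊆ x (y ∷ ys) (there i∈run) | true = there (run-⊆ y ys i∈run)

  block-⊆ : ∀ {i} xs → i ∈ block xs → i ∈ xs
  block-⊆ (x ∷ xs) (here i≡x)   = here i≡x
  block-⊆ (x ∷ xs) (there i∈run) = there (run-⊆ x xs i∈run)

  playableIdxs-⊆ : ∀ {i} bs → i ∈ playableIdxs bs → i ∈ bs
  playableIdxs-⊆ (b ∷ bs) i∈E with does (playableHead? (map (vlookup D) (b ∷ bs)))
  playableIdxs-⊆ (b ∷ bs) (here i≡b) | true = here i≡b
  playableIdxs-⊆ (b ∷ bs) (there i∈E) | true = there (playableIdxs-⊆ bs i∈E)
  ... | false = there (playableIdxs-⊆ bs i∈E)

  stageSet-⊆ : ∀ {i} U → i ∈ stageSet U → i ∈ U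
  stageSet-⊆ U i∈E = block-⊆ U (reverse⁻ (playableIdxs-⊆ _ i∈E))

  ∈-playableIdxs-last : ∀ u xs → u ∈ playableIdxs (xs ++ [ u ])
  ∈-playableIdxs-last u []
    rewrite dec-true (playableHead? (map (vlookup D) [ u ])) (singleton-playable _) = here refl
  ∈-playableIdxs-last u (x ∷ xs) with does (playableHead? (map (vlookup D) (x ∷ xs ++ [ u ])))
  ... | true  = there (∈-playableIdxs-last u xs)
  ... | false = ∈-playableIdxs-last u xs

  ∈-stageSet-head : ∀ u us → u ∈ stageSet (u ∷ us)
  ∈-stageSet-head u us =
    subst (λ bs → u ∈ playableIdxs bs) (sym (unfold-reverse u (run u us)))
          (∈-playableIdxs-last u (reverse (run u us)))

  ∈-removeAll⁻ : ∀ {i} E U → i ∈ removeAll E U → i ∈ U × ¬ i ∈ E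
  ∈-removeAll⁻ E U = ∈-filter⁻ (λ u → ¬? (u ∈? E))

  ∈-removeAll⁺ : ∀ {i} E U → i ∈ U → ¬ i ∈ E → i ∈ removeAll E U
  ∈-removeAll⁺ E U = ∈-filter⁺ (λ u → ¬? (u ∈? E))

  remaining : Fin k → List (Fin k) → List (Fin k)
  remaining u us = removeAll (stageSet (u ∷ us)) (u ∷ us)

  length-remaining : ∀ u us → length (remaining u us) ℕ.< suc (length us)
  length-remaining u us =
    filter-notAll (λ v → ¬? (v ∈? stageSet (u ∷ us))) (u ∷ us) (here (λ ¬u∈E → ¬u∈E (∈-stageSet-head u us)))

  loop-nonempty : ∀ n U (a : Fin (length (loop n U))) → lookup (loop n U) a ≢ []
  loop-nonempty (suc n) (u ∷ us) zero E≡[] with subst (u ∈_) E≡[] (∈-stageSet-head u us)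
  ... | ()
  loop-nonempty (suc n) (u ∷ us) (suc a) = loop-nonempty n _ a

  loop-⊆ : ∀ {i} n U (a : Fin (length (loop n U))) → i ∈ lookup (loop n U) a → i ∈ U
  loop-⊆ (suc n) (u ∷ us) zero    i∈E = stageSet-⊆ (u ∷ us) i∈E
  loop-⊆ (suc n) (u ∷ us) (suc a) i∈E = proj₁ (∈-removeAll⁻ (stageSet (u ∷ us)) (u ∷ us) (loop-⊆ n _ a i∈E))

  ∉-stageSet-of-later : ∀ {i} n u us (a : Fin (length (loop n (remaining u us)))) →
    i ∈ lookup (loop n (remaining u us)) a → ¬ i ∈ stageSet (u ∷ us)
  ∉-stageSet-of-later n u us a i∈E = proj₂ (∈-removeAll⁻ (stageSet (u ∷ us)) (u ∷ us) (loop-⊆ n _ a i∈E))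

  loop-disjoint : ∀ {i} n U (a b : Fin (length (loop n U))) →
    i ∈ lookup (loop n U) a → i ∈ lookup (loop n U) b → a ≡ b
  loop-disjoint (suc n) (u ∷ us) zero    zero    _    _    = refl
  loop-disjoint (suc n) (u ∷ us) zero    (suc b) i∈Ea i∈Eb = ⊥-elim (∉-stageSet-of-later n u us b i∈Eb i∈Ea)
  loop-disjoint (suc n) (u ∷ us) (suc a) zero    i∈Ea i∈Eb = ⊥-elim (∉-stageSet-of-later n u us a i∈Ea i∈Eb)
  loop-disjoint (suc n) (u ∷ us) (suc a) (suc b) i∈Ea i∈Eb = cong suc (loop-disjoint n _ a b i∈Ea i∈Eb)

  loop-covers : ∀ n U → length U ≤ n → ∀ {i} → i ∈ U → ∃[ a ] (i ∈ lookup (loop n U) a)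
  loop-covers (suc n) (u ∷ us) |U|≤1+n {i} i∈U with i ∈? stageSet (u ∷ us)
  ... | yes i∈E = zero , i∈E
  ... | no  i∉E with loop-covers n _ (≤-pred (≤-trans (length-remaining u us) |U|≤1+n))
                                    (∈-removeAll⁺ (stageSet (u ∷ us)) (u ∷ us) i∈U i∉E)
  ...   | a , i∈Ea = suc a , i∈Ea

  stageIndexIn-loop : ∀ {i} n U (a : Fin (length (loop n U))) →
    i ∈ lookup (loop n U) a → stageIndexIn (loop n U) i ≡ toℕ a
  stageIndexIn-loop {i} (suc n) (u ∷ us) zero i∈E
    rewrite dec-true (i ∈? stageSet (u ∷ us)) i∈E = refl
  stageIndexIn-loop {i} (suc n) (u ∷ us) (suc a) i∈E
    rewrite dec-false (i ∈? stageSet (u ∷ us)) (∉-stageSet-of-later n u us a i∈E) =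
      cong suc (stageIndexIn-loop n _ a i∈E)

  length-initial : length (reverse (allFin k)) ≤ k
  length-initial rewrite length-reverse (allFin k) | length-tabulate {n = k} (λ i → i) = ≤-refl

  stages-covers : ∀ i → ∃[ a ] (i ∈ lookup stages a)
  stages-covers i = loop-covers k _ length-initial (reverse⁺ (∈-allFin i))

  lookup-normalized : ∀ {i} a → i ∈ lookup stages a →
    vlookup normalized i ≡ recolour (colour (vlookup D i)) (2 * toℕ a + 1)
  lookup-normalized {i} a i∈E =
    trans (lookup∘tabulate _ i)
          (cong (λ s → recolour (colour (vlookup D i)) (2 * s + 1)) (stageIndexIn-loop k _ a i∈E))

  recolour-≥ : ∀ c p → p ≤ left (recolour c p) × p ≤ right (recolour c p)
  recolour-≥ blue  p = ≤-refl , n≤1+n p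
  recolour-≥ red   p = n≤1+n p , ≤-refl
  recolour-≥ green p = ≤-refl , ≤-refl

  recolour-≤ : ∀ c p → left (recolour c p) ≤ suc p × right (recolour c p) ≤ suc p
  recolour-≤ blue  p = n≤1+n p , ≤-refl
  recolour-≤ red   p = ≤-refl , n≤1+n p
  recolour-≤ green p = n≤1+n p , n≤1+n p

  2*-+1-gap : ∀ {x y} → x ℕ.< y → suc (2 * x + 1) ℕ.< 2 * y + 1
  2*-+1-gap {x} {y} x<y =
    subst (λ z → z + 1 ≤ 2 * y + 1) (cong suc (+-suc x (x + 0))) (+-monoˡ-≤ 1 (*-monoʳ-≤ 2 x<y))

  recolour-≺ : ∀ c c′ {x y} → x ℕ.< y → recolour c (2 * x + 1) ≺ recolour c′ (2 * y + 1)
  recolour-≺ c c′ {x} {y} x<y =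
      <-≤-trans (ℕ.s≤s l≤) (≤-trans gap ≤l′) , <-≤-trans (ℕ.s≤s l≤) (≤-trans gap ≤r′)
    , <-≤-trans (ℕ.s≤s r≤) (≤-trans gap ≤l′) , <-≤-trans (ℕ.s≤s r≤) (≤-trans gap ≤r′)
    where
    gap = 2*-+1-gap x<y
    l≤ = proj₁ (recolour-≤ c (2 * x + 1))
    r≤ = proj₂ (recolour-≤ c (2 * x + 1))
    ≤l′ = proj₁ (recolour-≥ c′ (2 * y + 1))
    ≤r′ = proj₂ (recolour-≥ c′ (2 * y + 1))

  normalized-≺ : ∀ {i j} a b → i ∈ lookup stages a → j ∈ lookup stages b → a < b →
    vlookup normalized i ≺ vlookup normalized j
  normalized-≺ {i} {j} a b i∈Ea j∈Eb a<b
    rewrite lookup-normalized a i∈Ea | lookup-normalized b j∈Eb =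
      recolour-≺ (colour (vlookup D i)) (colour (vlookup D j)) a<b

lemma3p3 : ∀ {k : ℕ} (D : Vec Domino k) →
    let open Normalization D
        E  = lookup stages
        D' = vlookup normalized
    in
    -- (1) E_1, …, E_f partition {indices}
    ((∀ a → E a ≢ [])
      × (∀ (i : Fin k) → ∃[ a ] (i ∈ E a))
      × (∀ (i : Fin k) a b → i ∈ E a → i ∈ E b → a ≡ b))
    -- (2) earlier stages have strictly smaller spots
    × (∀ (i j : Fin k) a b → i ∈ E a → j ∈ E b → a < b →
         (left (D' i) Data.Nat.< left (D' j)) × (left (D' i) Data.Nat.< right (D' j))
         × (right (D' i) Data.Nat.< left (D' j)) × (right (D' i) Data.Nat.< right (D' j)))
    -- (3) prevention in the normalized position
    × (∀ (i j : Fin k) a b → toℕ i Data.Nat.< toℕ j → i ∈ E a → j ∈ E b →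
         (a < b → ¬ Prevents (D' j) (D' i)) × (b < a → Prevents (D' j) (D' i)))
lemma3p3 {k} D =
    (loop-nonempty k _ , stages-covers , λ i a b → loop-disjoint k _ a b)
  , (λ i j a b → normalized-≺ a b)
  , λ i j a b _ i∈Ea j∈Eb →
        (λ a<b → ≺⇒¬Prevents (normalized-≺ a b i∈Ea j∈Eb a<b))
      , (λ b<a → ≻⇒Prevents  (normalized-≺ b a j∈Eb i∈Ea b<a))
  where open NormalizationProperties D
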